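{- Let $b\ge 2$ and $m\ge 0$ be integers. The box-selection procedure described in the context, in dimension $2$ with base $b$ and resolution $m$, terminates after exactly $b^m$ steps, regardless of which boxes are chosen.
   Context: An elementary $b$-adic interval in $[0,1)^s$ is a set $\prod_{j=1}^s\left[\frac{a_j}{b^{d_j}},\frac{a_j+1}{b^{d_j}}\right)$ with $d_j\in\mathbb{N}_0$ and $a_j\in\{0,1,\dots,b^{d_j}-1\}$. A grid box of resolution $m$ is a set $X=\prod_{j=1}^s\left[\frac{u_j}{b^m},\frac{u_j+1}{b^m}\right)$ with $u_j\in\{0,\dots,b^m-1\}$. For such $X$, $\mathcal{E}_m(X)$ denotes the set of all elementary $b$-adic intervals of volume $b^{ -m}$ containing $X$. The procedure (dimension $s$, here $s=2$): set $\mathcal{U}_1=[0,1)^s$ and $n=1$. While $\mathcal{U}_n\neq\emptyset$: choose an arbitrary grid box $X_n$ of resolution $m$ with $X_n\subseteq\mathcal{U}_n$, set $\mathcal{U}_{n+1}=\mathcal{U}_n\setminus\bigcup_{E\in\mathcal{E}_m(X_n)}E$, and increase $n$ by one. The output is the list of chosen boxes; the number of steps is the number of boxes chosen. -}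

module Defs where

open import Data.Nat using (ℕ; suc; _+_; _*_; _^_; _≤_; _<_)
open import Data.Fin using (Fin; toℕ)
open import Data.Product using (Σ; ∃; _×_; _,_)
open import Data.List using (List; length; take; lookup)
open import Data.List.Membership.Propositional using (_∈_)
open import Relation.Binary.PropositionalEquality using (_≡_)
open import Relation.Nullary using (¬_)

-- An elementary b-adic interval  [a₁/b^d₁,(a₁+1)/b^d₁) × [a₂/b^d₂,(a₂+1)/b^d₂)
-- with a_j ∈ {0,…,b^d_j − 1}.
record ElemInt (b : ℕ) : Set where
  constructor elem
  field
    d₁ d₂ : ℕ
    a₁ : Fin (b ^ d₁)
    a₂ : Fin (b ^ d₂)
open ElemInt public

-- Volume of an elementary interval is b^-(d₁+d₂); volume b^-m means d₁ + d₂ ≡ m.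
HasVolumeExp : ∀ {b} → ElemInt b → ℕ → Set
HasVolumeExp E m = d₁ E + d₂ E ≡ m

-- A grid box of resolution m:  [u₁/b^m,(u₁+1)/b^m) × [u₂/b^m,(u₂+1)/b^m).
Box : ℕ → ℕ → Set
Box b m = Fin (b ^ m) × Fin (b ^ m)

-- [u/b^m,(u+1)/b^m) ⊆ [a/b^d,(a+1)/b^d)  ⇔  a/b^d ≤ u/b^m  ∧  (u+1)/b^m ≤ (a+1)/b^d,
-- written with denominators cleared.
IntervalIncl : (b m u d a : ℕ) → Set
IntervalIncl b m u d a = (a * b ^ m ≤ u * b ^ d) × (suc u * b ^ d ≤ suc a * b ^ m)

BoxIn : (b m : ℕ) → Box b m → ElemInt b → Set
BoxIn b m (u₁ , u₂) E =
  IntervalIncl b m (toℕ u₁) (d₁ E) (toℕ (a₁ E)) ×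
  IntervalIncl b m (toℕ u₂) (d₂ E) (toℕ (a₂ E))

InEm : (b m : ℕ) → Box b m → ElemInt b → Set
InEm b m X E = HasVolumeExp E m × BoxIn b m X E

Removed : (b m : ℕ) → List (Box b m) → Box b m → Set
Removed b m xs Y =
  Σ (Box b m) λ X → X ∈ xs × Σ (ElemInt b) λ E → InEm b m X E × BoxIn b m Y E

-- A valid run of the procedure: each chosen box X_n lies in 𝓤_n, i.e. was not
-- removed by the boxes chosen before it (list in order of choice).
ValidRun : (b m : ℕ) → List (Box b m) → Set
ValidRun b m xs = ∀ i → ¬ Removed b m (take (toℕ i) xs) (lookup xs i)

Exhausted : (b m : ℕ) → List (Box b m) → Set
Exhausted b m xs = ∀ (Y : Box b m) → Removed b m xs Y

module Submission where

-- Read a grid box of resolution m as the point (u₁ , u₂) of the grid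
-- [0 , b^m)², and say two points share a cell when an elementary interval of
-- volume b^-m contains both.  A valid run is a list of points no two of which
-- share a cell; it is exhausted when every grid point shares a cell with one
-- of them.  Points in one column share the cell of x-resolution m, so the
-- chosen boxes occupy distinct columns: there are at most b^m of them, and
-- b^m of them occupy every column and thereby exhaust the grid.  Conversely
-- a separated covering set meets every column (every-column-occupied), by
-- induction on m: the points in one of the b vertical strips of level m+1,
-- rescaled, form a separated covering set of level m, where covering needs a
-- pigeonhole argument over b boxes stacked in one column.
-- The file develops counting on Fin and division facts, base-b digits
-- (Digits), the cell relation and the induction (Cells), the translation of
-- runs into point sets (Runs), and finally lemma4.

open import Defs
open import Data.Nat using (ℕ; zero; suc; _+_; _*_; _^_; _≤_; _<_; _≟_; NonZero; >-nonZero; z≤n; s≤s; s≤s⁻¹)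
open import Data.Nat.Properties
open import Data.Nat.DivMod
open import Data.Nat.Divisibility using (n∣m*n)
open import Data.Fin as Fin using (Fin; toℕ; fromℕ<)
open import Data.Fin.Properties using (toℕ-fromℕ<; toℕ-injective; fromℕ<-injective; toℕ<n; injective⇒≤; any?)
open import Data.Product using (∃; _×_; _,_; proj₁; proj₂; map₂)
open import Data.Sum using (_⊎_; inj₁; inj₂)
open import Data.Empty using (⊥-elim)
open import Data.List using (List; _∷_; map; filter; length; take; lookup)
open import Data.List.Relation.Unary.Any using (here; there; index)
open import Data.List.Relation.Unary.Any.Properties using (lookup-index)
open import Data.List.Membership.Propositional using (_∈_)
open import Data.List.Membership.Propositional.Properties using (∈-map⁺; ∈-map⁻; ∈-filter⁺; ∈-filter⁻; ∈-lookup)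
open import Function.Definitions using (Injective)
open import Relation.Nullary using (yes; no)
open import Relation.Binary.Definitions using (tri<; tri≈; tri>)
open import Relation.Binary.PropositionalEquality

-- An injective map Fin m → Fin n with n ≤ m hits every element: a missed
-- value could be prepended as a new image, giving an injection Fin (1+m) → Fin n.
injective⇒hits : ∀ {m n} (f : Fin m → Fin n) → Injective _≡_ _≡_ f → n ≤ m →
                 ∀ y → ∃ λ i → f i ≡ y
injective⇒hits {m} {n} f f-inj n≤m y with any? (λ i → f i Fin.≟ y)
... | yes hit = hit
... | no miss = ⊥-elim (1+n≰n (≤-trans (injective⇒≤ g-inj) n≤m))
  where
    g : Fin (suc m) → Fin n
    g Fin.zero    = y
    g (Fin.suc i) = f i
    g-inj : Injective _≡_ _≡_ g
    g-inj {Fin.zero}  {Fin.zero}  _ = refl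
    g-inj {Fin.zero}  {Fin.suc j} e = ⊥-elim (miss (j , sym e))
    g-inj {Fin.suc i} {Fin.zero}  e = ⊥-elim (miss (i , e))
    g-inj {Fin.suc i} {Fin.suc j} e = cong Fin.suc (f-inj e)

-- A map Fin m → Fin n hitting every element forces n ≤ m: choosing a
-- preimage of each element is an injection Fin n → Fin m.
hits⇒≥ : ∀ {m n} (f : Fin m → Fin n) → (∀ y → ∃ λ i → f i ≡ y) → n ≤ m
hits⇒≥ {m} {n} f hit = injective⇒≤ {f = preimage} preimage-inj
  where
    preimage : Fin n → Fin m
    preimage y = proj₁ (hit y)
    preimage-inj : Injective _≡_ _≡_ preimage
    preimage-inj {y} {y'} e = trans (sym (proj₂ (hit y))) (trans (cong f e) (proj₂ (hit y')))

lookup∈take : ∀ {A : Set} (xs : List A) (i j : Fin (length xs)) → toℕ i < toℕ j →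
              lookup xs i ∈ take (toℕ j) xs
lookup∈take (x ∷ xs) Fin.zero    (Fin.suc j) _         = here refl
lookup∈take (x ∷ xs) (Fin.suc i) (Fin.suc j) (s≤s i<j) = there (lookup∈take xs i j i<j)

[c*q+u]/q≡c : ∀ c u q .{{_ : NonZero q}} → u < q → (c * q + u) / q ≡ c
[c*q+u]/q≡c c u q u<q = begin
  (c * q + u) / q     ≡⟨ +-distrib-/-∣ˡ u (n∣m*n c) ⟩
  c * q / q + u / q   ≡⟨ cong₂ _+_ (m*n/n≡m c q) (m<n⇒m/n≡0 u<q) ⟩
  c + 0               ≡⟨ +-identityʳ c ⟩
  c                   ∎
  where open ≡-Reasoning

[c*q+u]%q≡u : ∀ c u q .{{_ : NonZero q}} → u < q → (c * q + u) % q ≡ u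
[c*q+u]%q≡u c u q u<q = begin
  (c * q + u) % q  ≡⟨ %-congˡ (+-comm (c * q) u) ⟩
  (u + c * q) % q  ≡⟨ [m+kn]%n≡m%n u c q ⟩
  u % q            ≡⟨ m<n⇒m%n≡m u<q ⟩
  u                ∎
  where open ≡-Reasoning

[c*q+u]<b*q : ∀ {c u b} q → c < b → u < q → c * q + u < b * q
[c*q+u]<b*q {c} {u} {b} q c<b u<q = begin-strict
  c * q + u  <⟨ +-monoʳ-< (c * q) u<q ⟩
  c * q + q  ≡⟨ +-comm (c * q) q ⟩
  suc c * q  ≤⟨ *-monoˡ-≤ q c<b ⟩
  b * q      ∎
  where open ≤-Reasoning

%-/-injective : ∀ {x x'} q .{{_ : NonZero q}} → x % q ≡ x' % q → x / q ≡ x' / q → x ≡ x'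
%-/-injective {x} {x'} q r≡ d≡ = begin
  x                  ≡⟨ m≡m%n+[m/n]*n x q ⟩
  x % q + x / q * q  ≡⟨ cong₂ (λ r d → r + d * q) r≡ d≡ ⟩
  x' % q + x' / q * q ≡⟨ sym (m≡m%n+[m/n]*n x' q) ⟩
  x'                 ∎
  where open ≡-Reasoning

bounds⇒≡/ : ∀ {a u} q .{{_ : NonZero q}} → a * q ≤ u → suc u ≤ suc a * q → a ≡ u / q
bounds⇒≡/ {a} {u} q lo hi = ≤-antisym a≤u/q (s≤s⁻¹ (m<n*o⇒m/o<n hi))
  where
    a≤u/q : a ≤ u / q
    a≤u/q = subst (_≤ u / q) (m*n/n≡m a q) (/-monoˡ-≤ q lo)

/-bounds : ∀ u q .{{_ : NonZero q}} → u / q * q ≤ u × suc u ≤ suc (u / q) * q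
/-bounds u q = m/n*n≤m u q , hi
  where
    hi : suc u ≤ q + u / q * q
    hi = subst (λ z → suc z ≤ q + u / q * q) (sym (m≡m%n+[m/n]*n u q))
               (+-monoˡ-≤ (u / q * q) (m%n<n u q))

-- Base-b digit arithmetic.  A coordinate of a grid box of resolution m is a
-- number below b^m, and an elementary interval fixes a block of its leading
-- base-b digits.
module Digits (b : ℕ) .{{_ : NonZero b}} where

  b^≢0 : ∀ e → NonZero (b ^ e)
  b^≢0 e = m^n≢0 b e

  infixl 7 _//_ _%%_

  _//_ _%%_ : ℕ → ℕ → ℕ
  x // e = _/_ x (b ^ e) {{b^≢0 e}}
  x %% e = _%_ x (b ^ e) {{b^≢0 e}}

  //-zero : ∀ x → x // 0 ≡ x
  //-zero = n/1≡n

  //-suc : ∀ x e → x // suc e ≡ (x / b) // e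
  //-suc x e = sym (m/n/o≡m/[n*o] x b (b ^ e))
    where instance _ = b^≢0 e
                   _ = b^≢0 (suc e)

  b^-+ : ∀ d₁ d₂ → b ^ (d₁ + d₂) ≡ b ^ d₂ * b ^ d₁
  b^-+ d₁ d₂ = trans (^-distribˡ-+-* b d₁ d₂) (*-comm (b ^ d₁) (b ^ d₂))

  //-+ : ∀ x d₁ d₂ → x // (d₁ + d₂) ≡ x // d₂ // d₁
  //-+ x d₁ d₂ = trans (/-congʳ (b^-+ d₁ d₂)) (sym (m/n/o≡m/[n*o] x (b ^ d₂) (b ^ d₁)))
    where instance _ = b^≢0 d₁
                   _ = b^≢0 d₂
                   _ = b^≢0 (d₁ + d₂)
                   _ = m*n≢0 (b ^ d₂) (b ^ d₁)

  //-split : ∀ x d₁ d₂ → x // d₂ ≡ x %% (d₁ + d₂) // d₂ + x // (d₁ + d₂) * b ^ d₁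
  //-split x d₁ d₂ = begin
    x // d₂                                  ≡⟨ m≡m%n+[m/n]*n (x // d₂) (b ^ d₁) ⟩
    x // d₂ % b ^ d₁ + x // d₂ // d₁ * b ^ d₁ ≡⟨ cong₂ (λ r d → r + d * b ^ d₁) low high ⟩
    x %% (d₁ + d₂) // d₂ + x // (d₁ + d₂) * b ^ d₁ ∎
    where
      open ≡-Reasoning
      instance _ = b^≢0 d₁
               _ = b^≢0 d₂
               _ = b^≢0 (d₁ + d₂)
               _ = m*n≢0 (b ^ d₁) (b ^ d₂)
      low : x // d₂ % b ^ d₁ ≡ x %% (d₁ + d₂) // d₂
      low = trans (sym (m%[n*o]/o≡m/o%n x (b ^ d₁) (b ^ d₂)))
                  (/-congˡ {o = b ^ d₂} (%-congʳ (sym (^-distribˡ-+-* b d₁ d₂))))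
      high : x // d₂ // d₁ ≡ x // (d₁ + d₂)
      high = sym (//-+ x d₁ d₂)

  agree-low⇒agree : ∀ {x x'} d₁ d₂ → x // (d₁ + d₂) ≡ x' // (d₁ + d₂) →
                    x %% (d₁ + d₂) // d₂ ≡ x' %% (d₁ + d₂) // d₂ → x // d₂ ≡ x' // d₂
  agree-low⇒agree {x} {x'} d₁ d₂ high low = begin
    x // d₂                                         ≡⟨ //-split x d₁ d₂ ⟩
    x %% (d₁ + d₂) // d₂ + x // (d₁ + d₂) * b ^ d₁   ≡⟨ cong₂ (λ r s → r + s * b ^ d₁) low high ⟩
    x' %% (d₁ + d₂) // d₂ + x' // (d₁ + d₂) * b ^ d₁ ≡⟨ sym (//-split x' d₁ d₂) ⟩
    x' // d₂                                        ∎
    where open ≡-Reasoning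

  agree⇒agree-low : ∀ {x x'} d₁ d₂ → x // (d₁ + d₂) ≡ x' // (d₁ + d₂) →
                    x // d₂ ≡ x' // d₂ → x %% (d₁ + d₂) // d₂ ≡ x' %% (d₁ + d₂) // d₂
  agree⇒agree-low {x} {x'} d₁ d₂ high agree = +-cancelʳ-≡ (x' // (d₁ + d₂) * b ^ d₁) _ _ (begin
    x %% (d₁ + d₂) // d₂ + x' // (d₁ + d₂) * b ^ d₁ ≡⟨ cong (λ s → x %% (d₁ + d₂) // d₂ + s * b ^ d₁) (sym high) ⟩
    x %% (d₁ + d₂) // d₂ + x // (d₁ + d₂) * b ^ d₁  ≡⟨ sym (//-split x d₁ d₂) ⟩
    x // d₂                                        ≡⟨ agree ⟩
    x' // d₂                                       ≡⟨ //-split x' d₁ d₂ ⟩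
    x' %% (d₁ + d₂) // d₂ + x' // (d₁ + d₂) * b ^ d₁ ∎)
    where open ≡-Reasoning

  %%-//-zero : ∀ x e → x %% e // e ≡ 0
  %%-//-zero x e = m<n⇒m/n≡0 (m%n<n x (b ^ e))
    where instance _ = b^≢0 e

  //-< : ∀ {x} d₁ d₂ → x < b ^ (d₁ + d₂) → x // d₂ < b ^ d₁
  //-< d₁ d₂ x< = m<n*o⇒m/o<n (subst (_ <_) (^-distribˡ-+-* b d₁ d₂) x<)
    where instance _ = b^≢0 d₂

  *-b^-+ : ∀ n d₁ d₂ → n * b ^ (d₁ + d₂) ≡ n * b ^ d₂ * b ^ d₁
  *-b^-+ n d₁ d₂ = trans (cong (n *_) (b^-+ d₁ d₂)) (sym (*-assoc n (b ^ d₂) (b ^ d₁)))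

  incl⇒≡// : ∀ {m u a} d₁ d₂ → d₁ + d₂ ≡ m → IntervalIncl b m u d₁ a → a ≡ u // d₂
  incl⇒≡// {u = u} {a} d₁ d₂ refl (lo , hi) = bounds⇒≡/ (b ^ d₂) lo′ hi′
    where
      instance _ = b^≢0 d₁
               _ = b^≢0 d₂
      lo′ : a * b ^ d₂ ≤ u
      lo′ = *-cancelʳ-≤ _ _ (b ^ d₁) (subst (_≤ u * b ^ d₁) (*-b^-+ a d₁ d₂) lo)
      hi′ : suc u ≤ suc a * b ^ d₂
      hi′ = *-cancelʳ-≤ _ _ (b ^ d₁) (subst (suc u * b ^ d₁ ≤_) (*-b^-+ (suc a) d₁ d₂) hi)

  ≡//⇒incl : ∀ {m u a} d₁ d₂ → d₁ + d₂ ≡ m → a ≡ u // d₂ → IntervalIncl b m u d₁ a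
  ≡//⇒incl {u = u} d₁ d₂ refl refl = lo , hi
    where
      instance _ = b^≢0 d₂
      bounds : u // d₂ * b ^ d₂ ≤ u × suc u ≤ suc (u // d₂) * b ^ d₂
      bounds = /-bounds u (b ^ d₂)
      lo : u // d₂ * b ^ (d₁ + d₂) ≤ u * b ^ d₁
      lo = subst (_≤ u * b ^ d₁) (sym (*-b^-+ (u // d₂) d₁ d₂)) (*-monoˡ-≤ (b ^ d₁) (proj₁ bounds))
      hi : suc u * b ^ d₁ ≤ suc (u // d₂) * b ^ (d₁ + d₂)
      hi = subst (suc u * b ^ d₁ ≤_) (sym (*-b^-+ (suc (u // d₂)) d₁ d₂)) (*-monoˡ-≤ (b ^ d₁) (proj₂ bounds))

-- Grid points and the relation of sharing an elementary interval.
module Cells (b : ℕ) .{{_ : NonZero b}} where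
  open Digits b

  -- A grid point (x , y) stands for the box with coordinate indices x and y.
  Point : Set
  Point = ℕ × ℕ

  -- p and p' lie in a common elementary interval of volume b^-m: for some
  -- split m = d₁ + d₂ their x-coordinates agree above digit position d₂
  -- and their y-coordinates agree above digit position d₁.
  data SameCell (m : ℕ) : Point → Point → Set where
    cell : ∀ d₁ d₂ {x y x' y'} → d₁ + d₂ ≡ m → x // d₂ ≡ x' // d₂ → y // d₁ ≡ y' // d₁ →
           SameCell m (x , y) (x' , y')

  SameCell-sym : ∀ {m p p'} → SameCell m p p' → SameCell m p' p
  SameCell-sym (cell d₁ d₂ split x≡ y≡) = cell d₁ d₂ split (sym x≡) (sym y≡)

  same-column⇒SameCell : ∀ m {x y y'} → y < b ^ m → y' < b ^ m → SameCell m (x , y) (x , y')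
  same-column⇒SameCell m y< y'< =
    cell m 0 (+-identityʳ m) refl (trans (m<n⇒m/n≡0 y<) (sym (m<n⇒m/n≡0 y'<)))
    where instance _ = b^≢0 m

  -- At level m+1 the grid splits into b vertical strips of width b^m;
  -- strip m p is the index of the strip containing p.
  strip : ℕ → Point → ℕ
  strip m p = proj₁ p // m

  -- Dropping the leading x-digit and the last y-digit rescales a strip of
  -- level m+1 onto the whole grid of level m.
  shrink : ℕ → Point → Point
  shrink m p = proj₁ p %% m , proj₂ p / b

  -- Within a strip, sharing a cell of level m+1 is sharing a cell of level
  -- m after shrinking (an x-resolution of d₁+1 becomes d₁).
  SameCell-lift : ∀ {m} p p' → strip m p ≡ strip m p' →
                  SameCell m (shrink m p) (shrink m p') → SameCell (suc m) p p'
  SameCell-lift (x , y) (x' , y') same-strip (cell d₁ d₂ refl x≡ y≡) =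
    cell (suc d₁) d₂ refl (agree-low⇒agree d₁ d₂ same-strip x≡)
         (trans (//-suc y d₁) (trans y≡ (sym (//-suc y' d₁))))

  SameCell-shrink : ∀ {m} p p' → strip m p ≡ strip m p' →
                    SameCell (suc m) p p' → SameCell m (shrink m p) (shrink m p')
  SameCell-shrink {m} (x , y) (x' , y') _ (cell zero _ refl _ y≡) =
    cell 0 m refl (trans (%%-//-zero x m) (sym (%%-//-zero x' m))) (cong (λ v → v / b // 0) same-y)
    where
      same-y : y ≡ y'
      same-y = trans (sym (//-zero y)) (trans y≡ (//-zero y'))
  SameCell-shrink (x , y) (x' , y') same-strip (cell (suc d₁) d₂ refl x≡ y≡) =
    cell d₁ d₂ refl (agree⇒agree-low d₁ d₂ same-strip x≡)
         (trans (sym (//-suc y d₁)) (trans y≡ (//-suc y' d₁)))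

  SameCell-row-or-strip : ∀ {m} p p' → SameCell (suc m) p p' → proj₂ p ≡ proj₂ p' ⊎ strip m p ≡ strip m p'
  SameCell-row-or-strip (x , y) (x' , y') (cell zero _ _ _ y≡) =
    inj₁ (trans (sym (//-zero y)) (trans y≡ (//-zero y')))
  SameCell-row-or-strip (x , y) (x' , y') (cell (suc d₁) d₂ refl x≡ _) =
    inj₂ (trans (//-+ x d₁ d₂) (trans (cong (_// d₁) x≡) (sym (//-+ x' d₁ d₂))))

  same-strip⇒SameCell : ∀ m {x y x' y'} → x // m ≡ x' // m → y / b ≡ y' / b →
                        SameCell (suc m) (x , y) (x' , y')
  same-strip⇒SameCell m {y = y} {y' = y'} x≡ y≡ =
    cell 1 m refl x≡ (trans (//-suc y 0) (trans (cong (_// 0) y≡) (sym (//-suc y' 0))))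

  InGrid : ℕ → Point → Set
  InGrid m p = proj₁ p < b ^ m × proj₂ p < b ^ m

  Bounded Separated Covering : ℕ → List Point → Set
  Bounded m P = ∀ {p} → p ∈ P → InGrid m p
  Separated m P = ∀ {p p'} → p ∈ P → p' ∈ P → SameCell m p p' → p ≡ p'
  Covering m P = ∀ q → InGrid m q → ∃ λ p → p ∈ P × SameCell m p q

  -- The induction step: the points of P lying in strip c of level m+1,
  -- shrunk to level m, again form a bounded, separated, covering set.
  module Strip (m : ℕ) (P : List Point) (bounded : Bounded (suc m) P)
               (separated : Separated (suc m) P) (covering : Covering (suc m) P)
               (c : ℕ) (c<b : c < b) where

    P′ : List Point
    P′ = map (shrink m) (filter (λ p → strip m p ≟ c) P)

    ∈P′⁺ : ∀ {p} → p ∈ P → strip m p ≡ c → shrink m p ∈ P′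
    ∈P′⁺ p∈P in-c = ∈-map⁺ (shrink m) (∈-filter⁺ (λ p → strip m p ≟ c) p∈P in-c)

    ∈P′⁻ : ∀ {p′} → p′ ∈ P′ → ∃ λ p → p ∈ P × strip m p ≡ c × p′ ≡ shrink m p
    ∈P′⁻ p′∈P′ with ∈-map⁻ (shrink m) p′∈P′
    ... | p , p∈filter , refl with ∈-filter⁻ (λ p → strip m p ≟ c) p∈filter
    ...   | p∈P , in-c = p , p∈P , in-c , refl

    strip<b : ∀ {p} → p ∈ P → strip m p < b
    strip<b p∈P = m<n*o⇒m/o<n (proj₁ (bounded p∈P))
      where instance _ = b^≢0 m

    P′-bounded : Bounded m P′
    P′-bounded p′∈P′ with ∈P′⁻ p′∈P′
    ... | (x , y) , p∈P , _ , refl =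
      m%n<n x (b ^ m) , m<n*o⇒m/o<n (subst (y <_) (*-comm b (b ^ m)) (proj₂ (bounded p∈P)))
      where instance _ = b^≢0 m

    P′-separated : Separated m P′
    P′-separated p′∈P′ q′∈P′ same with ∈P′⁻ p′∈P′ | ∈P′⁻ q′∈P′
    ... | p , p∈P , p-in-c , refl | q , q∈P , q-in-c , refl =
      cong (shrink m) (separated p∈P q∈P (SameCell-lift p q (trans p-in-c (sym q-in-c)) same))

    -- Let w t ∈ P cover the box (x , v·b + t) of strip c,
    -- for each t < b.  Some w t lies in strip c: otherwise every w t lies in
    -- row v·b + t (SameCell-row-or-strip), so distinct w t lie in distinct
    -- strips (same-strip⇒SameCell and separation), hence one lies in strip c.
    cover-meets-strip : ∀ x v → x // m ≡ c → (w : Fin b → Point) → (∀ t → w t ∈ P) →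
                        (∀ t → SameCell (suc m) (w t) (x , v * b + toℕ t)) →
                        ∃ λ t → strip m (w t) ≡ c
    cover-meets-strip x v x-in-c w w∈P w-covers with any? (λ t → strip m (w t) ≟ c)
    ... | yes found = found
    ... | no none = map₂ (λ {t} → fromℕ<-injective _ c _ c<b)
                         (injective⇒hits strip-of strip-of-injective ≤-refl (fromℕ< c<b))
      where
        row : ∀ t → proj₂ (w t) ≡ v * b + toℕ t
        row t with SameCell-row-or-strip (w t) _ (w-covers t)
        ... | inj₁ same-row   = same-row
        ... | inj₂ same-strip = ⊥-elim (none (t , trans same-strip x-in-c))

        strip-of : Fin b → Fin b
        strip-of t = fromℕ< (strip<b (w∈P t))

        strip-of-injective : Injective _≡_ _≡_ strip-of
        strip-of-injective {i} {j} eq =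
          toℕ-injective (+-cancelˡ-≡ (v * b) _ _ (trans (sym (row i)) (trans (cong proj₂ same-point) (row j))))
          where
            same-strip : strip m (w i) ≡ strip m (w j)
            same-strip = fromℕ<-injective _ _ _ _ eq
            row-block : ∀ t → proj₂ (w t) / b ≡ v
            row-block t = trans (cong (_/ b) (row t)) ([c*q+u]/q≡c v (toℕ t) b (toℕ<n t))
            same-point : w i ≡ w j
            same-point = separated (w∈P i) (w∈P j)
                           (same-strip⇒SameCell m same-strip (trans (row-block i) (sym (row-block j))))

    -- The b boxes (c·b^m + u , v·b + t) of strip c all shrink to (u , v).
    target : ℕ → ℕ → Fin b → Point
    target u v t = c * b ^ m + u , v * b + toℕ t

    target-in-grid : ∀ {u v} → u < b ^ m → v < b ^ m → ∀ t → InGrid (suc m) (target u v t)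
    target-in-grid {u} {v} u< v< t =
      [c*q+u]<b*q (b ^ m) c<b u< ,
      subst (v * b + toℕ t <_) (*-comm (b ^ m) b) ([c*q+u]<b*q b v< (toℕ<n t))

    target-in-strip : ∀ {u} → u < b ^ m → (c * b ^ m + u) // m ≡ c
    target-in-strip {u} u< = [c*q+u]/q≡c c u (b ^ m) {{b^≢0 m}} u<

    shrink-target : ∀ {u v} → u < b ^ m → ∀ t → shrink m (target u v t) ≡ (u , v)
    shrink-target {u} {v} u< t =
      cong₂ _,_ ([c*q+u]%q≡u c u (b ^ m) {{b^≢0 m}} u<) ([c*q+u]/q≡c v (toℕ t) b (toℕ<n t))

    -- Covers of the targets of (u , v) exist at level m+1; one of them lies in
    -- strip c (cover-meets-strip) and shrinks to a cover of (u , v).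
    P′-covering : Covering m P′
    P′-covering (u , v) (u< , v<) = shrunk-cover
      (cover-meets-strip (c * b ^ m + u) v (target-in-strip u<) w (λ t → proj₁ (proj₂ (cover t)))
                         (λ t → proj₂ (proj₂ (cover t))))
      where
        cover : ∀ t → ∃ λ p → p ∈ P × SameCell (suc m) p (target u v t)
        cover t = covering (target u v t) (target-in-grid u< v< t)
        w : Fin b → Point
        w t = proj₁ (cover t)
        shrunk-cover : (∃ λ t → strip m (w t) ≡ c) → ∃ λ p′ → p′ ∈ P′ × SameCell m p′ (u , v)
        shrunk-cover (t , w-in-c) with cover t
        ... | p , p∈P , p-covers =
          shrink m p , ∈P′⁺ p∈P w-in-c ,
          subst (SameCell m (shrink m p)) (shrink-target u< t)
                (SameCell-shrink p (target u v t) (trans w-in-c (sym (target-in-strip u<))) p-covers)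

    unshrink-column : ∀ x → x // m ≡ c → (∃ λ p′ → p′ ∈ P′ × proj₁ p′ ≡ x %% m) →
                      ∃ λ p → p ∈ P × proj₁ p ≡ x
    unshrink-column x x-in-c (p′ , p′∈P′ , column) with ∈P′⁻ p′∈P′
    ... | p , p∈P , p-in-c , refl = p , p∈P , %-/-injective (b ^ m) {{b^≢0 m}} column (trans p-in-c (sym x-in-c))

  every-column-occupied : ∀ m P → Bounded m P → Separated m P → Covering m P →
                          ∀ x → x < b ^ m → ∃ λ p → p ∈ P × proj₁ p ≡ x
  every-column-occupied zero P bounded _ covering x x<1 with covering (0 , 0) (s≤s z≤n , s≤s z≤n)
  ... | p , p∈P , _ = p , p∈P , trans (n<1⇒n≡0 (proj₁ (bounded p∈P))) (sym (n<1⇒n≡0 x<1))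
  every-column-occupied (suc m) P bounded separated covering x x< =
    unshrink-column x refl
      (every-column-occupied m P′ P′-bounded P′-separated P′-covering (x %% m) (m%n<n x (b ^ m)))
    where
      instance _ = b^≢0 m
      open Strip m P bounded separated covering (x // m) (m<n*o⇒m/o<n x<)

-- Runs of the procedure at resolution m, read as point sets in the grid.
module Runs (b : ℕ) .{{_ : NonZero b}} (m : ℕ) where
  open Digits b
  open Cells b

  point : Box b m → Point
  point (u , v) = toℕ u , toℕ v

  point-in-grid : ∀ X → InGrid m (point X)
  point-in-grid (u , v) = toℕ<n u , toℕ<n v

  Removed⇒SameCell : ∀ {xs Y} → Removed b m xs Y → ∃ λ X → X ∈ xs × SameCell m (point X) (point Y)
  Removed⇒SameCell ((x₁ , x₂) , X∈xs , elem d₁ d₂ a₁ a₂ , (split , x₁∈ , x₂∈) , (y₁∈ , y₂∈)) =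
    (x₁ , x₂) , X∈xs ,
    cell d₁ d₂ split (trans (sym (incl⇒≡// {a = toℕ a₁} d₁ d₂ split x₁∈)) (incl⇒≡// d₁ d₂ split y₁∈))
                     (trans (sym (incl⇒≡// {a = toℕ a₂} d₂ d₁ split′ x₂∈)) (incl⇒≡// d₂ d₁ split′ y₂∈))
    where
      split′ : d₂ + d₁ ≡ m
      split′ = trans (+-comm d₂ d₁) split

  SameCell⇒Removed : ∀ {xs X Y} → X ∈ xs → SameCell m (point X) (point Y) → Removed b m xs Y
  SameCell⇒Removed {X = x₁ , x₂} {_ , _} X∈xs (cell d₁ d₂ split x≡ y≡) =
    (x₁ , x₂) , X∈xs , elem d₁ d₂ lead₁ lead₂ ,
    (split , ≡//⇒incl d₁ d₂ split lead₁≡ , ≡//⇒incl d₂ d₁ split′ lead₂≡) ,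
    (≡//⇒incl d₁ d₂ split (trans lead₁≡ x≡) , ≡//⇒incl d₂ d₁ split′ (trans lead₂≡ y≡))
    where
      split′ : d₂ + d₁ ≡ m
      split′ = trans (+-comm d₂ d₁) split
      x₁< : toℕ x₁ // d₂ < b ^ d₁
      x₁< = //-< d₁ d₂ (subst (λ e → toℕ x₁ < b ^ e) (sym split) (toℕ<n x₁))
      x₂< : toℕ x₂ // d₁ < b ^ d₂
      x₂< = //-< d₂ d₁ (subst (λ e → toℕ x₂ < b ^ e) (sym split′) (toℕ<n x₂))
      lead₁ : Fin (b ^ d₁)
      lead₁ = fromℕ< x₁<
      lead₂ : Fin (b ^ d₂)
      lead₂ = fromℕ< x₂<
      lead₁≡ : toℕ lead₁ ≡ toℕ x₁ // d₂
      lead₁≡ = toℕ-fromℕ< x₁<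
      lead₂≡ : toℕ lead₂ ≡ toℕ x₂ // d₁
      lead₂≡ = toℕ-fromℕ< x₂<

  boxes-in-column⇒SameCell : ∀ {X Y : Box b m} → proj₁ X ≡ proj₁ Y → SameCell m (point X) (point Y)
  boxes-in-column⇒SameCell {u , v} {.u , v'} refl = same-column⇒SameCell m (toℕ<n v) (toℕ<n v')

  module ValidRuns (xs : List (Box b m)) (valid : ValidRun b m xs) where

    -- Entries of a valid run never share a cell: the later one would have
    -- been removed by the earlier one.
    entries-apart : ∀ i j → SameCell m (point (lookup xs i)) (point (lookup xs j)) → i ≡ j
    entries-apart i j same with <-cmp (toℕ i) (toℕ j)
    ... | tri< i<j _ _ = ⊥-elim (valid j (SameCell⇒Removed (lookup∈take xs i j i<j) same))
    ... | tri≈ _ i≡j _ = toℕ-injective i≡j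
    ... | tri> _ _ j<i = ⊥-elim (valid i (SameCell⇒Removed (lookup∈take xs j i j<i) (SameCell-sym same)))

    column : Fin (length xs) → Fin (b ^ m)
    column i = proj₁ (lookup xs i)

    column-injective : Injective _≡_ _≡_ column
    column-injective {i} {j} eq = entries-apart i j (boxes-in-column⇒SameCell eq)

    points : List Point
    points = map point xs

    points-bounded : Bounded m points
    points-bounded p∈ with ∈-map⁻ point p∈
    ... | X , _ , refl = point-in-grid X

    points-separated : Separated m points
    points-separated p∈ q∈ same with ∈-map⁻ point p∈ | ∈-map⁻ point q∈
    ... | X , X∈xs , refl | Y , Y∈xs , refl
      rewrite lookup-index X∈xs | lookup-index Y∈xs =
      cong (λ i → point (lookup xs i)) (entries-apart (index X∈xs) (index Y∈xs) same)

    exhausted⇒covering : Exhausted b m xs → Covering m points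
    exhausted⇒covering exhausted (y₁ , y₂) (y₁< , y₂<)
      with Removed⇒SameCell (exhausted (fromℕ< y₁< , fromℕ< y₂<))
    ... | X , X∈xs , same =
      point X , ∈-map⁺ point X∈xs ,
      subst (SameCell m (point X)) (cong₂ _,_ (toℕ-fromℕ< y₁<) (toℕ-fromℕ< y₂<)) same

    exhausted⇒columns-hit : Exhausted b m xs → ∀ u → ∃ λ i → column i ≡ u
    exhausted⇒columns-hit exhausted u
      with every-column-occupied m points points-bounded points-separated
             (exhausted⇒covering exhausted) (toℕ u) (toℕ<n u)
    ... | p , p∈ , p-column with ∈-map⁻ point p∈
    ...   | X , X∈xs , refl rewrite lookup-index X∈xs = index X∈xs , toℕ-injective p-column

    columns-hit⇒exhausted : (∀ u → ∃ λ i → column i ≡ u) → Exhausted b m xs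
    columns-hit⇒exhausted hit (u , v) with hit u
    ... | i , column≡u = SameCell⇒Removed (∈-lookup i) (boxes-in-column⇒SameCell {Y = u , v} column≡u)

lemma4 : (b m : ℕ) → 2 ≤ b → (xs : List (Box b m)) → ValidRun b m xs →
           (Exhausted b m xs → length xs ≡ b ^ m) × (length xs ≡ b ^ m → Exhausted b m xs)
lemma4 b m 2≤b xs valid = exhausted⇒length , length⇒exhausted
  where
    instance
      b≢0 : NonZero b
      b≢0 = >-nonZero (<-≤-trans (s≤s z≤n) 2≤b)
    open Runs b m
    open ValidRuns xs valid

    exhausted⇒length : Exhausted b m xs → length xs ≡ b ^ m
    exhausted⇒length exhausted =
      ≤-antisym (injective⇒≤ column-injective) (hits⇒≥ column (exhausted⇒columns-hit exhausted))

    length⇒exhausted : length xs ≡ b ^ m → Exhausted b m xs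
    length⇒exhausted len = columns-hit⇒exhausted (injective⇒hits column column-injective (≤-reflexive (sym len)))
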